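{- For every hypergraph $\Gamma=(\Omega,\mathcal X)$, every $\mathbf p\in(0,1)^\Omega$ and every positive integer $k$, \[\Delta_{k+1}/\Delta_k\le\Lambda_k(\Gamma,\mathbf p)\quad\text{and}\quad\delta_{k+1}/\delta_k\le\Lambda_k(\Gamma,\mathbf p),\] i.e. $\Delta_{k+1}\le\Lambda_k(\Gamma,\mathbf p)\Delta_k$ and $\delta_{k+1}\le\Lambda_k(\Gamma,\mathbf p)\delta_k$.
   Context: $\Omega$ is finite, $\mathcal X$ a set of subsets of $\Omega$, $\Omega_{\mathbf p}$ the random subset containing each $\omega$ independently with probability $p_\omega$. Edges are ordered $\gamma_1,\dots,\gamma_N$; $X_i$ is the indicator of $\gamma_i\subseteq\Omega_{\mathbf p}$ and $X_V=\prod_{i\in V}X_i$. The dependency graph $G_\Gamma$ on $[N]$ joins $i\ne j$ iff $\gamma_i\cap\gamma_j\ne\emptyset$; $\partial(V)$ is the set of vertices outside $V$ adjacent to a vertex of $V$. $\lambda(V)=\sum_{i\in\partial(V)}\mathbb E[X_i\mid X_V=1]$, $\Lambda_k(\Gamma,\mathbf p)=\max\{\lambda(V):V\subseteq[N],1\le|V|\le k\}$. $\mathcal C_k$ is the family of $k$-element $V\subseteq[N]$ with $G_\Gamma[V]$ connected; $\Delta_k=\sum_{V\in\mathcal C_k}\mathbb E[X_V]$ and $\delta_k=\sum_{V\in\mathcal C_k}\mathbb E[X_V]\max_{i\in V}\mathbb E[X_i]$. -}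

module Defs where

open import Level using (Level; _⊔_) renaming (suc to lsuc)
open import Algebra.Bundles using (CommutativeRing)
open import Relation.Binary.Core using (Rel)
open import Relation.Binary.Structures using (IsTotalOrder)
open import Relation.Binary.PropositionalEquality using (_≡_)
open import Relation.Nullary using (¬_; Dec; yes; no)
open import Relation.Nullary.Decidable using (_×-dec_; ¬?)
open import Data.Nat using (ℕ)
open import Data.Fin using (Fin)
open import Data.Fin.Properties using (any?; _≟_)
open import Data.Fin.Subset using (Subset; _∈_; _∉_; _∩_; Nonempty)
open import Data.Fin.Subset.Properties using (_∈?_; nonempty?)
open import Data.Product using (Σ; _×_; ∃)
open import Data.List using (List; foldr; map; filter; allFin)
open import Data.List.Membership.Propositional using () renaming (_∈_ to _∈ˡ_)
open import Data.List.Relation.Unary.Unique.Propositional using (Unique)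
open import Function.Bundles using (_⇔_)

-- Scalars: an arbitrary ordered commutative ring (e.g. ℝ).  Only ring
-- operations and the order are needed to state the result.

record OrderedCommRing (c ℓ₁ ℓ₂ : Level) : Set (lsuc (c ⊔ ℓ₁ ⊔ ℓ₂)) where
  field
    commutativeRing : CommutativeRing c ℓ₁
  open CommutativeRing commutativeRing public
  field
    _≤_          : Rel Carrier ℓ₂
    isTotalOrder : IsTotalOrder _≈_ _≤_
    +-monoˡ-≤    : ∀ {a b} c → a ≤ b → (a + c) ≤ (b + c)
    *-nonneg     : ∀ {a b} → 0# ≤ a → 0# ≤ b → 0# ≤ (a * b)

  _<_ : Rel Carrier (ℓ₁ ⊔ ℓ₂)
  a < b = (a ≤ b) × ¬ (a ≈ b)

module _ {c ℓ₁ ℓ₂ : Level} (R : OrderedCommRing c ℓ₁ ℓ₂) where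
  open OrderedCommRing R

  sumR : List Carrier → Carrier
  sumR = foldr _+_ 0#

  prodR : List Carrier → Carrier
  prodR = foldr _*_ 1#

  IsMaxOver : ∀ {a ℓ} {A : Set a} → (A → Set ℓ) → (A → Carrier) → Carrier → Set (a ⊔ ℓ ⊔ ℓ₁ ⊔ ℓ₂)
  IsMaxOver P f x = (∃ λ v → P v × (f v ≈ x)) × (∀ v → P v → f v ≤ x)

  module Hyp {m N : ℕ} (γ : Fin N → Subset m) (p : Fin m → Carrier) where

    Covered : Subset N → Fin m → Set
    Covered V ω = ∃ λ j → j ∈ V × ω ∈ γ j

    covered? : (V : Subset N) (ω : Fin m) → Dec (Covered V ω)
    covered? V ω = any? (λ j → (j ∈? V) ×-dec (ω ∈? γ j))

    -- E[X_V] = ∏_{ω ∈ ⋃_{j∈V} γ_j} p_ω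
    EX : Subset N → Carrier
    EX V = prodR (map p (filter (covered? V) (allFin m)))

    -- E[X_i] = ∏_{ω ∈ γ_i} p_ω
    EXi : Fin N → Carrier
    EXi i = prodR (map p (filter (_∈? γ i) (allFin m)))

    -- E[X_i | X_V = 1] = ∏_{ω ∈ γ_i \ ⋃_{j∈V} γ_j} p_ω
    -- (= E[X_i X_V]/E[X_V], computed without division, all p_ω > 0)
    EXcond : Fin N → Subset N → Carrier
    EXcond i V =
      prodR (map p (filter (λ ω → (ω ∈? γ i) ×-dec ¬? (covered? V ω)) (allFin m)))

    Adj : Fin N → Fin N → Set
    Adj i j = ¬ (i ≡ j) × Nonempty (γ i ∩ γ j)

    adj? : (i j : Fin N) → Dec (Adj i j)
    adj? i j = ¬? (i ≟ j) ×-dec nonempty? (γ i ∩ γ j)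

    InBoundary : Subset N → Fin N → Set
    InBoundary V i = i ∉ V × ∃ λ j → j ∈ V × Adj i j

    inBoundary? : (V : Subset N) (i : Fin N) → Dec (InBoundary V i)
    inBoundary? V i = ¬? (i ∈? V) ×-dec any? (λ j → (j ∈? V) ×-dec adj? i j)

    lam : Subset N → Carrier
    lam V = sumR (map (λ i → EXcond i V) (filter (inBoundary? V) (allFin N)))

    data Walk (V : Subset N) : Fin N → Fin N → Set where
      here  : ∀ {i} → i ∈ V → Walk V i i
      step  : ∀ {i j l} → i ∈ V → Adj i j → Walk V j l → Walk V i l

    Connected : Subset N → Set
    Connected V = ∀ i j → i ∈ V → j ∈ V → Walk V i j

-- A list enumerates a predicate exactly once (used to express finite sums
-- over a family of subsets defined by a predicate).

Enumerates : ∀ {a ℓ} {A : Set a} → List A → (A → Set ℓ) → Set (a ⊔ ℓ)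
Enumerates L P = Unique L × (∀ x → (x ∈ˡ L) ⇔ P x)

{-# OPTIONS --safe #-}

-- A connected (k+1)-set W with a chosen vertex a splits as W = V ∪ {i} with V a connected k-set
-- containing a and i ∈ ∂(V): grow a connected set from a inside W, one boundary vertex at a time,
-- and stop one step short. As E[X_W] = E[X_V] E[X_i | X_V = 1], charging W to the pair (V, i) gives
--   Δ_{k+1} ≤ Σ_{V ∈ 𝒞_k} Σ_{i ∈ ∂(V)} E[X_V] E[X_i | X_V = 1] = Σ_{V ∈ 𝒞_k} E[X_V] λ(V) ≤ Λ_k Δ_k,
-- distinct W receiving distinct pairs. For δ, root W at a vertex a maximising E[X_a]; then
-- max_{j ∈ W} E[X_j] = E[X_a] ≤ max_{j ∈ V} E[X_j].

module Submission where

open import Defs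
open import Level using (Level)
open import Data.Nat using (ℕ; suc; _≥_; _≤_; s≤s; z≤n)
open import Data.Nat.Properties using (≤-refl)
open import Data.Fin using (Fin; zero; suc)
open import Data.Fin.Properties using (any?)
open import Data.Fin.Subset using (Subset; _∈_; _∉_; _⊆_; _∪_; ⁅_⁆; ∣_∣; Nonempty; inside; outside)
open import Data.Fin.Subset.Properties
  using ( _∈?_; ⊆-antisym; p⊂q⇒∣p∣<∣q∣; p⊆q⇒∣p∣≤∣q∣; x∈p∪q⁻; p⊆p∪q; q⊆p∪q; x∈⁅x⁆; x∈⁅y⁆⇒x≡y
        ; ∣⁅x⁆∣≡1; x∈p∩q⁺; x∈p∩q⁻; ∪-identityʳ)
open import Data.Vec.Base using (_∷_; here; there)
open import Data.Product using (_×_; _,_; proj₁; proj₂; ∃; ∃₂; swap)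
open import Data.Sum using (_⊎_; inj₁; inj₂; [_,_]′)
open import Data.Empty using (⊥-elim)
open import Data.List using (List; []; _∷_; map; filter; allFin; concatMap; _++_)
open import Data.List.Properties using (map-∘)
open import Data.List.Membership.Propositional using (find) renaming (_∈_ to _∈ˡ_)
open import Data.List.Membership.Propositional.Properties
  using (∈-map⁺; ∈-map⁻; ∈-concatMap⁺; ∈-concatMap⁻; ∈-filter⁺; ∈-allFin)
open import Data.List.Relation.Unary.Any as Any using (here; there)
open import Data.List.Relation.Unary.All as All using ()
open import Data.List.Relation.Unary.AllPairs using (_∷_)
open import Data.List.Relation.Unary.Unique.Propositional using (Unique)
open import Function.Base using (_∘_)
open import Function.Bundles using (Equivalence)
open import Function.Definitions using (Injective)
open import Relation.Binary.Bundles using (Poset)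
open import Relation.Binary.Structures using (IsTotalOrder)
open import Relation.Binary.PropositionalEquality as ≡ using (_≡_; _≢_)
open import Relation.Nullary using (¬_; yes; no)
open import Relation.Nullary.Decidable using (_×-dec_; ¬?; decidable-stable)
open import Relation.Unary using (Decidable)
import Algebra.Properties.Ring as RingProperties
import Algebra.Properties.CommutativeSemigroup as CommutativeSemigroupProperties
import Relation.Binary.Reasoning.PartialOrder as ≤-Reasoning

module OrderedCommRingProperties {c ℓ₁ ℓ₂ : Level} (R : OrderedCommRing c ℓ₁ ℓ₂) where

  open OrderedCommRing R renaming (_≤_ to infix 4 _≤R_)
  open IsTotalOrder isTotalOrder using (isPartialOrder; total)
  open IsTotalOrder isTotalOrder public using () renaming (reflexive to ≤-reflexive)
  open RingProperties ring using (-‿involutive; -‿distribˡ-*; -‿distribʳ-*; x[y-z]≈xy-xz)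
  open CommutativeSemigroupProperties +-commutativeSemigroup using () renaming (x∙yz≈y∙xz to x+[y+z]≈y+[x+z])
  open CommutativeSemigroupProperties *-commutativeSemigroup using () renaming (x∙yz≈y∙xz to x*[y*z]≈y*[x*z])
  open CommutativeSemigroupProperties *-commutativeSemigroup public
    using () renaming (xy∙z≈xz∙y to [x*y]*z≈[x*z]*y)

  poset : Poset c ℓ₁ ℓ₂
  poset = record { isPartialOrder = isPartialOrder }

  open ≤-Reasoning poset

  +-mono-≤ : ∀ {a b x y} → a ≤R b → x ≤R y → a + x ≤R b + y
  +-mono-≤ {a} {b} {x} {y} a≤b x≤y = begin
    a + x ≤⟨ +-monoˡ-≤ x a≤b ⟩
    b + x ≈⟨ +-comm b x ⟩
    x + b ≤⟨ +-monoˡ-≤ b x≤y ⟩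
    y + b ≈⟨ +-comm y b ⟩
    b + y ∎

  x≤y⇒0≤y-x : ∀ {x y} → x ≤R y → 0# ≤R y - x
  x≤y⇒0≤y-x {x} {y} x≤y = begin
    0#    ≈⟨ -‿inverseʳ x ⟨
    x - x ≤⟨ +-monoˡ-≤ (- x) x≤y ⟩
    y - x ∎

  0≤y-x⇒x≤y : ∀ {x y} → 0# ≤R y - x → x ≤R y
  0≤y-x⇒x≤y {x} {y} 0≤y-x = begin
    x            ≈⟨ +-identityˡ x ⟨
    0# + x       ≤⟨ +-monoˡ-≤ x 0≤y-x ⟩
    y - x + x    ≈⟨ +-assoc y (- x) x ⟩
    y + (- x + x) ≈⟨ +-congˡ (-‿inverseˡ x) ⟩
    y + 0#       ≈⟨ +-identityʳ y ⟩
    y ∎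

  *-monoʳ-≤-nonNeg : ∀ {z x y} → 0# ≤R z → x ≤R y → z * x ≤R z * y
  *-monoʳ-≤-nonNeg {z} {x} {y} 0≤z x≤y = 0≤y-x⇒x≤y (begin
    0#              ≤⟨ *-nonneg 0≤z (x≤y⇒0≤y-x x≤y) ⟩
    z * (y - x)     ≈⟨ x[y-z]≈xy-xz z y x ⟩
    z * y - z * x   ∎)

  x*x≥0 : ∀ x → 0# ≤R x * x
  x*x≥0 x with total 0# x
  ... | inj₁ 0≤x = *-nonneg 0≤x 0≤x
  ... | inj₂ x≤0 = begin
    0#           ≤⟨ *-nonneg 0≤-x 0≤-x ⟩
    - x * - x    ≈⟨ -‿distribˡ-* x (- x) ⟨
    - (x * - x)  ≈⟨ -‿cong (-‿distribʳ-* x x) ⟨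
    - (- (x * x)) ≈⟨ -‿involutive (x * x) ⟩
    x * x ∎
    where
    0≤-x : 0# ≤R - x
    0≤-x = begin
      0#     ≤⟨ x≤y⇒0≤y-x x≤0 ⟩
      0# - x ≈⟨ +-identityˡ (- x) ⟩
      - x ∎

  0≤1 : 0# ≤R 1#
  0≤1 = begin
    0#        ≤⟨ x*x≥0 1# ⟩
    1# * 1#   ≈⟨ *-identityˡ 1# ⟩
    1# ∎

  module _ {a} {A : Set a} where

    sumR-++ : ∀ (f : A → Carrier) xs ys →
              sumR R (map f (xs ++ ys)) ≈ sumR R (map f xs) + sumR R (map f ys)
    sumR-++ f []       ys = sym (+-identityˡ _)
    sumR-++ f (x ∷ xs) ys = trans (+-congˡ (sumR-++ f xs ys)) (sym (+-assoc _ _ _))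

    *-distribˡ-sumR : ∀ z (f : A → Carrier) xs → z * sumR R (map f xs) ≈ sumR R (map ((z *_) ∘ f) xs)
    *-distribˡ-sumR z f []       = zeroʳ z
    *-distribˡ-sumR z f (x ∷ xs) = trans (distribˡ z _ _) (+-congˡ (*-distribˡ-sumR z f xs))

    sumR-mono-≤ : ∀ {f g : A → Carrier} xs → (∀ {x} → x ∈ˡ xs → f x ≤R g x) →
                  sumR R (map f xs) ≤R sumR R (map g xs)
    sumR-mono-≤ []       f≤g = ≤-reflexive refl
    sumR-mono-≤ (x ∷ xs) f≤g = +-mono-≤ (f≤g (here ≡.refl)) (sumR-mono-≤ xs (f≤g ∘ there))

    0≤sumR : ∀ {f : A → Carrier} xs → (∀ {x} → x ∈ˡ xs → 0# ≤R f x) → 0# ≤R sumR R (map f xs)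
    0≤sumR       []       f≥0 = ≤-reflexive refl
    0≤sumR {f} (x ∷ xs) f≥0 = begin
      0#                     ≈⟨ +-identityˡ 0# ⟨
      0# + 0#                ≤⟨ +-mono-≤ (f≥0 (here ≡.refl)) (0≤sumR xs (f≥0 ∘ there)) ⟩
      f x + sumR R (map f xs) ∎

    0≤prodR : ∀ {f : A → Carrier} xs → (∀ x → 0# ≤R f x) → 0# ≤R prodR R (map f xs)
    0≤prodR []       f≥0 = 0≤1
    0≤prodR (x ∷ xs) f≥0 = *-nonneg (f≥0 x) (0≤prodR xs f≥0)

    module _ {P Q S : A → Set} (P? : Decidable P) (Q? : Decidable Q) (S? : Decidable S)
             (P⇒Q⊎S : ∀ {x} → P x → Q x ⊎ S x) (Q⊎S⇒P : ∀ {x} → Q x ⊎ S x → P x)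
             (Q⇒¬S : ∀ {x} → Q x → ¬ S x) (f : A → Carrier) where

      prodR-filter-⊎ : ∀ xs → prodR R (map f (filter P? xs)) ≈
                              prodR R (map f (filter Q? xs)) * prodR R (map f (filter S? xs))
      prodR-filter-⊎ [] = sym (*-identityˡ 1#)
      prodR-filter-⊎ (x ∷ xs) with P? x | Q? x | S? x
      ... | _      | yes q | yes s = ⊥-elim (Q⇒¬S q s)
      ... | yes _  | yes _ | no _  = trans (*-congˡ (prodR-filter-⊎ xs)) (sym (*-assoc _ _ _))
      ... | yes _  | no _  | yes _ = trans (*-congˡ (prodR-filter-⊎ xs)) (x*[y*z]≈y*[x*z] _ _ _)
      ... | yes p  | no ¬q | no ¬s = ⊥-elim ([ ¬q , ¬s ]′ (P⇒Q⊎S p))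
      prodR-filter-⊎ (x ∷ xs) | no ¬p | yes q | no _  = ⊥-elim (¬p (Q⊎S⇒P (inj₁ q)))
      prodR-filter-⊎ (x ∷ xs) | no ¬p | no _  | yes s = ⊥-elim (¬p (Q⊎S⇒P (inj₂ s)))
      prodR-filter-⊎ (x ∷ xs) | no _  | no _  | no _  = prodR-filter-⊎ xs

  sumR-extract : ∀ {b} {B : Set b} (g : B → Carrier) {y} {M : List B} → y ∈ˡ M →
    ∃ λ M′ → sumR R (map g M) ≈ g y + sumR R (map g M′)
           × (∀ {z} → z ∈ˡ M′ → z ∈ˡ M)
           × (∀ {z} → z ∈ˡ M → z ≢ y → z ∈ˡ M′)
  sumR-extract g {M = _ ∷ M} (here ≡.refl) =
    M , refl , there , λ { (here z≡y) z≢y → ⊥-elim (z≢y z≡y) ; (there z∈M) _ → z∈M }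
  sumR-extract g {M = x ∷ M} (there y∈M) with sumR-extract g y∈M
  ... | M′ , sum≈ , M′⊆M , M∖y⊆M′ =
    x ∷ M′ ,
    trans (+-congˡ sum≈) (x+[y+z]≈y+[x+z] (g x) _ _) ,
    (λ { (here z≡x) → here z≡x ; (there z∈M′) → there (M′⊆M z∈M′) }) ,
    (λ { (here z≡x) _ → here z≡x ; (there z∈M) z≢y → there (M∖y⊆M′ z∈M z≢y) })

  sumR-≤-by-injection : ∀ {a b} {A : Set a} {B : Set b} (h : B → A) (f : A → Carrier) (g : B → Carrier)
    (L : List A) (M : List B) → Unique L → (∀ {y} → y ∈ˡ M → 0# ≤R g y) →
    (∀ {x} → x ∈ˡ L → ∃ λ y → y ∈ˡ M × h y ≡ x × f x ≤R g y) →
    sumR R (map f L) ≤R sumR R (map g M)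
  sumR-≤-by-injection h f g [] M _ g≥0 _ = 0≤sumR M g≥0
  sumR-≤-by-injection h f g (x ∷ L) M (x∉L ∷ L-unique) g≥0 charge
    with y , y∈M , ≡.refl , fx≤gy ← charge (here ≡.refl)
    with M′ , sum≈ , M′⊆M , M∖y⊆M′ ← sumR-extract g y∈M = begin
    f (h y) + sumR R (map f L)
      ≤⟨ +-mono-≤ fx≤gy (sumR-≤-by-injection h f g L M′ L-unique (g≥0 ∘ M′⊆M) charge′) ⟩
    g y + sumR R (map g M′)  ≈⟨ sum≈ ⟨
    sumR R (map g M) ∎
    where
    charge′ : ∀ {x′} → x′ ∈ˡ L → ∃ λ y′ → y′ ∈ˡ M′ × h y′ ≡ x′ × f x′ ≤R g y′
    charge′ x′∈L with y′ , y′∈M , ≡.refl , fx′≤gy′ ← charge (there x′∈L) =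
      y′ , M∖y⊆M′ y′∈M (λ { ≡.refl → All.lookup x∉L x′∈L ≡.refl }) , ≡.refl , fx′≤gy′

module SubsetProperties where

  open import Data.Nat using (_<_)
  open import Data.Nat.Properties using (<-irrefl; ≤-trans)

  private variable
    n : ℕ
    p q : Subset n
    x : Fin n

  ∣p∪⁅x⁆∣≡1+∣p∣ : x ∉ p → ∣ p ∪ ⁅ x ⁆ ∣ ≡ suc ∣ p ∣
  ∣p∪⁅x⁆∣≡1+∣p∣ {x = zero}  {outside ∷ p} _   = ≡.cong (suc ∘ ∣_∣) (∪-identityʳ p)
  ∣p∪⁅x⁆∣≡1+∣p∣ {x = zero}  {inside  ∷ p} x∉p = ⊥-elim (x∉p here)
  ∣p∪⁅x⁆∣≡1+∣p∣ {x = suc x} {outside ∷ p} x∉p = ∣p∪⁅x⁆∣≡1+∣p∣ (x∉p ∘ there)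
  ∣p∪⁅x⁆∣≡1+∣p∣ {x = suc x} {inside  ∷ p} x∉p = ≡.cong suc (∣p∪⁅x⁆∣≡1+∣p∣ (x∉p ∘ there))

  ∣p∣≡1+k⇒Nonempty : ∀ {k} → ∣ p ∣ ≡ suc k → Nonempty p
  ∣p∣≡1+k⇒Nonempty {p = inside  ∷ p} _ = zero , here
  ∣p∣≡1+k⇒Nonempty {p = outside ∷ p} ∣p∣≡1+k with ∣p∣≡1+k⇒Nonempty ∣p∣≡1+k
  ... | x , x∈p = suc x , there x∈p

  ⊆⊎∃∈∖ : ∀ (p q : Subset n) → q ⊆ p ⊎ ∃ λ x → x ∈ q × x ∉ p
  ⊆⊎∃∈∖ p q with any? (λ x → (x ∈? q) ×-dec ¬? (x ∈? p))
  ... | yes x∈q∖p = inj₂ x∈q∖p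
  ... | no  q∖p-empty =
    inj₁ λ {x} x∈q → decidable-stable (x ∈? p) (λ x∉p → q∖p-empty (x , x∈q , x∉p))

  ∣p∣<∣q∣⇒∃∈q∖p : ∣ p ∣ < ∣ q ∣ → ∃ λ x → x ∈ q × x ∉ p
  ∣p∣<∣q∣⇒∃∈q∖p {p = p} {q} ∣p∣<∣q∣ with ⊆⊎∃∈∖ p q
  ... | inj₁ q⊆p   = ⊥-elim (<-irrefl ≡.refl (≤-trans ∣p∣<∣q∣ (p⊆q⇒∣p∣≤∣q∣ q⊆p)))
  ... | inj₂ x∈q∖p = x∈q∖p

  ⊆∧∣p∣≡∣q∣⇒p≡q : p ⊆ q → ∣ p ∣ ≡ ∣ q ∣ → p ≡ q
  ⊆∧∣p∣≡∣q∣⇒p≡q {p = p} {q} p⊆q ∣p∣≡∣q∣ with ⊆⊎∃∈∖ p q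
  ... | inj₁ q⊆p   = ⊆-antisym p⊆q q⊆p
  ... | inj₂ x∈q∖p = ⊥-elim (<-irrefl ∣p∣≡∣q∣ (p⊂q⇒∣p∣<∣q∣ (p⊆q , x∈q∖p)))

  ⁅x⁆⊆p : x ∈ p → ⁅ x ⁆ ⊆ p
  ⁅x⁆⊆p {x = x} {p} x∈p y∈⁅x⁆ = ≡.subst (_∈ p) (≡.sym (x∈⁅y⁆⇒x≡y x y∈⁅x⁆)) x∈p

  p∪⁅x⁆⊆q : p ⊆ q → x ∈ q → p ∪ ⁅ x ⁆ ⊆ q
  p∪⁅x⁆⊆q {p = p} {x = x} p⊆q x∈q y∈p∪⁅x⁆ with x∈p∪q⁻ p ⁅ x ⁆ y∈p∪⁅x⁆
  ... | inj₁ y∈p   = p⊆q y∈p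
  ... | inj₂ y∈⁅x⁆ = ⁅x⁆⊆p x∈q y∈⁅x⁆

module DependencyGraphProperties {c ℓ₁ ℓ₂ : Level} (R : OrderedCommRing c ℓ₁ ℓ₂) {m N : ℕ}
  (γ : Fin N → Subset m) (p : Fin m → OrderedCommRing.Carrier R) where

  open import Data.Nat using (zero; _+_; _<_; z<s)
  open import Data.Nat.Properties using (+-suc; +-comm; m<n+m; suc-injective)
  open Hyp R γ p
  open SubsetProperties

  private variable
    S V W : Subset N
    a i j l : Fin N

  Adj-sym : Adj i j → Adj j i
  Adj-sym (i≢j , ω , ω∈γi∩γj) = i≢j ∘ ≡.sym , ω , x∈p∩q⁺ (swap (x∈p∩q⁻ _ _ ω∈γi∩γj))

  walk-start : Walk V i j → i ∈ V
  walk-start (here i∈V)     = i∈V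
  walk-start (step i∈V _ _) = i∈V

  walk-++ : Walk V i j → Walk V j l → Walk V i l
  walk-++ (here _)          w = w
  walk-++ (step i∈V i~j w′) w = step i∈V i~j (walk-++ w′ w)

  walk-⊆ : V ⊆ W → Walk V i j → Walk W i j
  walk-⊆ V⊆W (here i∈V)       = here (V⊆W i∈V)
  walk-⊆ V⊆W (step i∈V i~j w) = step (V⊆W i∈V) i~j (walk-⊆ V⊆W w)

  walk-exits : Walk W i j → i ∈ S → j ∉ S → ∃ λ u → u ∈ W × InBoundary S u
  walk-exits (here _) i∈S j∉S = ⊥-elim (j∉S i∈S)
  walk-exits {S = S} (step {j = k} _ i~k w) i∈S j∉S with k ∈? S
  ... | yes k∈S = walk-exits w k∈S j∉S
  ... | no  k∉S = k , walk-start w , k∉S , _ , i∈S , Adj-sym i~k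

  connected-⁅⁆ : Connected ⁅ i ⁆
  connected-⁅⁆ {i} x y x∈⁅i⁆ y∈⁅i⁆
    rewrite x∈⁅y⁆⇒x≡y i x∈⁅i⁆ | x∈⁅y⁆⇒x≡y i y∈⁅i⁆ = here (x∈⁅x⁆ i)

  connected-∪⁅⁆ : Connected S → j ∈ S → Adj i j → Connected (S ∪ ⁅ i ⁆)
  connected-∪⁅⁆ {S} {j} {i} S-conn j∈S i~j x y x∈ y∈ = walk-++ (to-j x∈) (from-j y∈)
    where
    S⊆S′ : S ⊆ S ∪ ⁅ i ⁆
    S⊆S′ = p⊆p∪q ⁅ i ⁆
    i∈S′ : i ∈ S ∪ ⁅ i ⁆
    i∈S′ = q⊆p∪q S ⁅ i ⁆ (x∈⁅x⁆ i)

    to-j : ∀ {x} → x ∈ S ∪ ⁅ i ⁆ → Walk (S ∪ ⁅ i ⁆) x j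
    to-j {x} x∈ with x∈p∪q⁻ S ⁅ i ⁆ x∈
    ... | inj₁ x∈S   = walk-⊆ S⊆S′ (S-conn x j x∈S j∈S)
    ... | inj₂ x∈⁅i⁆ rewrite x∈⁅y⁆⇒x≡y i x∈⁅i⁆ = step i∈S′ i~j (here (S⊆S′ j∈S))

    from-j : ∀ {y} → y ∈ S ∪ ⁅ i ⁆ → Walk (S ∪ ⁅ i ⁆) j y
    from-j {y} y∈ with x∈p∪q⁻ S ⁅ i ⁆ y∈
    ... | inj₁ y∈S   = walk-⊆ S⊆S′ (S-conn j y j∈S y∈S)
    ... | inj₂ y∈⁅i⁆ rewrite x∈⁅y⁆⇒x≡y i y∈⁅i⁆ = step (S⊆S′ j∈S) (Adj-sym i~j) (here i∈S′)

  module _ (W-conn : Connected W) (a∈W : a ∈ W) where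

    boundary-vertex : a ∈ S → ∣ S ∣ < ∣ W ∣ → ∃ λ u → u ∈ W × InBoundary S u
    boundary-vertex a∈S ∣S∣<∣W∣ with v , v∈W , v∉S ← ∣p∣<∣q∣⇒∃∈q∖p ∣S∣<∣W∣ =
      walk-exits (W-conn _ v a∈W v∈W) a∈S v∉S

    grow : ∀ n → S ⊆ W → a ∈ S → Connected S → suc n + ∣ S ∣ ≡ ∣ W ∣ →
           ∃₂ λ V i → suc ∣ V ∣ ≡ ∣ W ∣ × Connected V × InBoundary V i × V ∪ ⁅ i ⁆ ≡ W × a ∈ V
    grow {S} n S⊆W a∈S S-conn ∣W∣≡ with boundary-vertex a∈S (≡.subst (∣ S ∣ <_) ∣W∣≡ (m<n+m ∣ S ∣ z<s))
    grow {S} zero S⊆W a∈S S-conn ∣W∣≡ | u , u∈W , u∂S@(u∉S , _) =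
      S , u , ∣W∣≡ , S-conn , u∂S , S∪⁅u⁆≡W , a∈S
      where
      S∪⁅u⁆≡W : S ∪ ⁅ u ⁆ ≡ W
      S∪⁅u⁆≡W = ⊆∧∣p∣≡∣q∣⇒p≡q (p∪⁅x⁆⊆q S⊆W u∈W) (≡.trans (∣p∪⁅x⁆∣≡1+∣p∣ u∉S) ∣W∣≡)
    grow {S} (suc n) S⊆W a∈S S-conn ∣W∣≡ | u , u∈W , u∉S , j , j∈S , u~j =
      grow n (p∪⁅x⁆⊆q S⊆W u∈W) (p⊆p∪q ⁅ u ⁆ a∈S) (connected-∪⁅⁆ S-conn j∈S u~j)
        (≡.trans (≡.cong (suc n +_) (∣p∪⁅x⁆∣≡1+∣p∣ u∉S)) (≡.trans (+-suc (suc n) ∣ S ∣) ∣W∣≡))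

    connected-peel : ∀ {k} → ∣ W ∣ ≡ suc (suc k) →
      ∃₂ λ V i → (∣ V ∣ ≡ suc k × Connected V) × InBoundary V i × V ∪ ⁅ i ⁆ ≡ W × a ∈ V
    connected-peel {k} ∣W∣≡
      with V , i , 1+∣V∣≡∣W∣ , V-conn , i∂V , V∪i≡W , a∈V
           ← grow k (⁅x⁆⊆p a∈W) (x∈⁅x⁆ a) connected-⁅⁆
                  (≡.trans (≡.cong (suc k +_) (∣⁅x⁆∣≡1 a)) (≡.trans (+-comm (suc k) 1) (≡.sym ∣W∣≡))) =
      V , i , (suc-injective (≡.trans 1+∣V∣≡∣W∣ ∣W∣≡) , V-conn) , i∂V , V∪i≡W , a∈V

module ExpectationProperties {c ℓ₁ ℓ₂ : Level} (R : OrderedCommRing c ℓ₁ ℓ₂) {m N : ℕ}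
  (γ : Fin N → Subset m) (p : Fin m → OrderedCommRing.Carrier R) where

  open OrderedCommRing R renaming (_≤_ to infix 4 _≤R_)
  open OrderedCommRingProperties R
  open ≤-Reasoning poset
  open Hyp R γ p
  open DependencyGraphProperties R γ p using (connected-peel)
  open SubsetProperties using (∣p∣≡1+k⇒Nonempty)

  private variable
    V W : Subset N
    Vs : List (Subset N)
    a i : Fin N

  EX-∪⁅⁆ : ∀ V i → EX (V ∪ ⁅ i ⁆) ≈ EX V * EXcond i V
  EX-∪⁅⁆ V i =
    prodR-filter-⊎ (covered? (V ∪ ⁅ i ⁆)) (covered? V) (λ ω → (ω ∈? γ i) ×-dec ¬? (covered? V ω))
                   split join (λ cov (_ , ¬cov) → ¬cov cov) p (allFin m)
    where
    split : ∀ {ω} → Covered (V ∪ ⁅ i ⁆) ω → Covered V ω ⊎ (ω ∈ γ i × ¬ Covered V ω)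
    split {ω} (j , j∈ , ω∈γj) with covered? V ω | x∈p∪q⁻ V ⁅ i ⁆ j∈
    ... | yes cov | _          = inj₁ cov
    ... | no ¬cov | inj₁ j∈V   = ⊥-elim (¬cov (j , j∈V , ω∈γj))
    ... | no ¬cov | inj₂ j∈⁅i⁆ rewrite x∈⁅y⁆⇒x≡y i j∈⁅i⁆ = inj₂ (ω∈γj , ¬cov)

    join : ∀ {ω} → Covered V ω ⊎ (ω ∈ γ i × ¬ Covered V ω) → Covered (V ∪ ⁅ i ⁆) ω
    join (inj₁ (j , j∈V , ω∈γj)) = j , p⊆p∪q ⁅ i ⁆ j∈V , ω∈γj
    join (inj₂ (ω∈γi , _))       = i , q⊆p∪q V ⁅ i ⁆ (x∈⁅x⁆ i) , ω∈γi

  boundary : Subset N → List (Fin N)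
  boundary V = filter (inBoundary? V) (allFin N)

  boundaryPairs : List (Subset N) → List (Subset N × Fin N)
  boundaryPairs = concatMap (λ V → map (V ,_) (boundary V))

  boundaryPairs⁺ : V ∈ˡ Vs → InBoundary V i → (V , i) ∈ˡ boundaryPairs Vs
  boundaryPairs⁺ {V} {i = i} V∈Vs i∂V =
    ∈-concatMap⁺ _ (Any.map (λ { ≡.refl → ∈-map⁺ (V ,_) i∈∂V }) V∈Vs)
    where
    i∈∂V : i ∈ˡ boundary V
    i∈∂V = ∈-filter⁺ (inBoundary? V) (∈-allFin i) i∂V

  boundaryPairs⁻ : (V , i) ∈ˡ boundaryPairs Vs → V ∈ˡ Vs
  boundaryPairs⁻ Vi∈ with V′ , V′∈Vs , Vi∈V′×∂V′ ← find (∈-concatMap⁻ _ Vi∈)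
                     with _ , _ , ≡.refl ← ∈-map⁻ (V′ ,_) Vi∈V′×∂V′ = V′∈Vs

  sumR-boundaryPairs : ∀ (g : Subset N × Fin N → Carrier) Vs →
    sumR R (map g (boundaryPairs Vs)) ≈ sumR R (map (λ V → sumR R (map (λ i → g (V , i)) (boundary V))) Vs)
  sumR-boundaryPairs g []       = refl
  sumR-boundaryPairs g (V ∷ Vs) = begin-equality
    sumR R (map g (map (V ,_) (boundary V) ++ boundaryPairs Vs))
      ≈⟨ sumR-++ g (map (V ,_) (boundary V)) (boundaryPairs Vs) ⟩
    sumR R (map g (map (V ,_) (boundary V))) + sumR R (map g (boundaryPairs Vs))
      ≡⟨ ≡.cong (λ xs → sumR R xs + _) (map-∘ (boundary V)) ⟨
    sumR R (map (λ i → g (V , i)) (boundary V)) + sumR R (map g (boundaryPairs Vs))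
      ≈⟨ +-congˡ (sumR-boundaryPairs g Vs) ⟩
    sumR R (map (λ V → sumR R (map (λ i → g (V , i)) (boundary V))) (V ∷ Vs)) ∎

  module NonNegative (p≥0 : ∀ ω → 0# ≤R p ω) where

    EX≥0 : ∀ V → 0# ≤R EX V
    EX≥0 V = 0≤prodR (filter (covered? V) (allFin m)) p≥0

    EXi≥0 : ∀ i → 0# ≤R EXi i
    EXi≥0 i = 0≤prodR (filter (_∈? γ i) (allFin m)) p≥0

    EXcond≥0 : ∀ i V → 0# ≤R EXcond i V
    EXcond≥0 i V = 0≤prodR (filter (λ ω → (ω ∈? γ i) ×-dec ¬? (covered? V ω)) (allFin m)) p≥0

    extension-charging : ∀ {Λ} (Ck Ck1 : List (Subset N)) (f : Subset N → Carrier) → Unique Ck1 →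
      (∀ {V} → V ∈ˡ Ck → lam V ≤R Λ) → (∀ {V} → V ∈ˡ Ck → 0# ≤R f V) →
      (∀ {W} → W ∈ˡ Ck1 →
         ∃₂ λ V i → V ∈ˡ Ck × InBoundary V i × V ∪ ⁅ i ⁆ ≡ W × f W ≤R f V * EXcond i V) →
      sumR R (map f Ck1) ≤R Λ * sumR R (map f Ck)
    extension-charging {Λ} Ck Ck1 f Ck1-unique λ≤Λ f≥0 charge = begin
      sumR R (map f Ck1)
        ≤⟨ sumR-≤-by-injection (λ (V , i) → V ∪ ⁅ i ⁆) f g Ck1 (boundaryPairs Ck) Ck1-unique g≥0 charge′ ⟩
      sumR R (map g (boundaryPairs Ck))
        ≈⟨ sumR-boundaryPairs g Ck ⟩
      sumR R (map (λ V → sumR R (map (λ i → g (V , i)) (boundary V))) Ck)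
        ≤⟨ sumR-mono-≤ Ck charges-of ⟩
      sumR R (map ((Λ *_) ∘ f) Ck)
        ≈⟨ *-distribˡ-sumR Λ f Ck ⟨
      Λ * sumR R (map f Ck) ∎
      where
      g : Subset N × Fin N → Carrier
      g (V , i) = f V * EXcond i V

      g≥0 : ∀ {Vi} → Vi ∈ˡ boundaryPairs Ck → 0# ≤R g Vi
      g≥0 {V , i} Vi∈ = *-nonneg (f≥0 (boundaryPairs⁻ Vi∈)) (EXcond≥0 i V)

      charge′ : ∀ {W} → W ∈ˡ Ck1 →
        ∃ λ Vi → Vi ∈ˡ boundaryPairs Ck × proj₁ Vi ∪ ⁅ proj₂ Vi ⁆ ≡ W × f W ≤R g Vi
      charge′ W∈ with V , i , V∈ , i∂V , V∪i≡W , fW≤ ← charge W∈ =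
        (V , i) , boundaryPairs⁺ V∈ i∂V , V∪i≡W , fW≤

      charges-of : ∀ {V} → V ∈ˡ Ck → sumR R (map (λ i → g (V , i)) (boundary V)) ≤R Λ * f V
      charges-of {V} V∈ = begin
        sumR R (map (λ i → f V * EXcond i V) (boundary V))
          ≈⟨ *-distribˡ-sumR (f V) (λ i → EXcond i V) (boundary V) ⟨
        f V * lam V  ≤⟨ *-monoʳ-≤-nonNeg (f≥0 V∈) (λ≤Λ V∈) ⟩
        f V * Λ      ≈⟨ *-comm (f V) Λ ⟩
        Λ * f V ∎

    ExtensionBound : (Subset N → Carrier) → Subset N → Set ℓ₂
    ExtensionBound f W =
      ∃ λ a → a ∈ W × (∀ {V i} → a ∈ V → V ∪ ⁅ i ⁆ ≡ W → f W ≤R f V * EXcond i V)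

    EX-extensionBound : a ∈ W → ExtensionBound EX W
    EX-extensionBound {a} a∈W = a , a∈W , λ { {V} {i} _ ≡.refl → ≤-reflexive (EX-∪⁅⁆ V i) }

    sum𝒞ₖ₊₁≤Λ*sum𝒞ₖ : ∀ {k Λ} {Ck Ck1 : List (Subset N)} →
      Enumerates Ck (λ V → ∣ V ∣ ≡ suc k × Connected V) →
      Enumerates Ck1 (λ W → ∣ W ∣ ≡ suc (suc k) × Connected W) →
      (∀ {V} → ∣ V ∣ ≡ suc k → lam V ≤R Λ) →
      (f : Subset N → Carrier) → (∀ {V} → Nonempty V → 0# ≤R f V) →
      (∀ {W} → Nonempty W → ExtensionBound f W) →
      sumR R (map f Ck1) ≤R Λ * sumR R (map f Ck)
    sum𝒞ₖ₊₁≤Λ*sum𝒞ₖ {k} {Ck = Ck} {Ck1} (_ , Ck-spec) (Ck1-unique , Ck1-spec) λ≤Λ f f≥0 f-bound =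
      extension-charging Ck Ck1 f Ck1-unique
        (λ V∈ → λ≤Λ (size V∈)) (λ V∈ → f≥0 (∣p∣≡1+k⇒Nonempty (size V∈))) charge
      where
      size : ∀ {V} → V ∈ˡ Ck → ∣ V ∣ ≡ suc k
      size V∈ = proj₁ (Equivalence.to (Ck-spec _) V∈)

      charge : ∀ {W} → W ∈ˡ Ck1 →
        ∃₂ λ V i → V ∈ˡ Ck × InBoundary V i × V ∪ ⁅ i ⁆ ≡ W × f W ≤R f V * EXcond i V
      charge W∈ with ∣W∣≡ , W-conn ← Equivalence.to (Ck1-spec _) W∈
                with a , a∈W , f-ext ← f-bound (∣p∣≡1+k⇒Nonempty ∣W∣≡)
                with V , i , V-spec , i∂V , V∪i≡W , a∈V ← connected-peel W-conn a∈W ∣W∣≡ =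
        V , i , Equivalence.from (Ck-spec V) V-spec , i∂V , V∪i≡W , f-ext a∈V V∪i≡W

    module MaxEXi (mx : Subset N → Carrier) (mx-max : ∀ V → Nonempty V → IsMaxOver R (_∈ V) EXi (mx V)) where

      EX*mx≥0 : Nonempty V → 0# ≤R EX V * mx V
      EX*mx≥0 {V} V≠∅ with (a , _ , EXa≈mxV) , _ ← mx-max V V≠∅ = *-nonneg (EX≥0 V) (begin
        0#    ≤⟨ EXi≥0 a ⟩
        EXi a ≈⟨ EXa≈mxV ⟩
        mx V ∎)

      EX*mx-∪⁅⁆ : a ∈ V → EXi a ≈ mx (V ∪ ⁅ i ⁆) →
                  EX (V ∪ ⁅ i ⁆) * mx (V ∪ ⁅ i ⁆) ≤R (EX V * mx V) * EXcond i V
      EX*mx-∪⁅⁆ {a} {V} {i} a∈V EXa≈mxW = begin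
        EX (V ∪ ⁅ i ⁆) * mx (V ∪ ⁅ i ⁆) ≈⟨ *-cong (EX-∪⁅⁆ V i) (sym EXa≈mxW) ⟩
        (EX V * EXcond i V) * EXi a     ≤⟨ *-monoʳ-≤-nonNeg (*-nonneg (EX≥0 V) (EXcond≥0 i V)) EXa≤mxV ⟩
        (EX V * EXcond i V) * mx V      ≈⟨ [x*y]*z≈[x*z]*y (EX V) (EXcond i V) (mx V) ⟩
        (EX V * mx V) * EXcond i V ∎
        where
        EXa≤mxV : EXi a ≤R mx V
        EXa≤mxV = proj₂ (mx-max V (a , a∈V)) a a∈V

      EX*mx-extensionBound : Nonempty W → ExtensionBound (λ V → EX V * mx V) W
      EX*mx-extensionBound {W} W≠∅ with (a , a∈W , EXa≈mxW) , _ ← mx-max W W≠∅ =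
        a , a∈W , λ { a∈V ≡.refl → EX*mx-∪⁅⁆ a∈V EXa≈mxW }

lemma2p1 : ∀ {c ℓ₁ ℓ₂ : Level} (R : OrderedCommRing c ℓ₁ ℓ₂) →
    let open OrderedCommRing R renaming (_≤_ to _≤R_) in
    ∀ (m N : ℕ) (γ : Fin N → Subset m) →
    Injective _≡_ _≡_ γ →
    (p : Fin m → Carrier) →
    (∀ ω → (0# < p ω) × (p ω < 1#)) →
    let open Hyp R γ p in
    ∀ (k : ℕ) → k ≥ 1 →
    -- Λ = Λ_k(Γ, p)
    ∀ (Λ : Carrier) →
    IsMaxOver R (λ V → (1 ≤ ∣ V ∣) × (∣ V ∣ ≤ k)) lam Λ →
    -- mx V = max_{i ∈ V} E[X_i]
    ∀ (mx : Subset N → Carrier) →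
    (∀ V → Nonempty V → IsMaxOver R (λ i → i ∈ V) EXi (mx V)) →
    -- Ck, Ck1 list the families 𝒞_k, 𝒞_{k+1}, each member exactly once
    ∀ (Ck Ck1 : List (Subset N)) →
    Enumerates Ck (λ V → (∣ V ∣ ≡ k) × Connected V) →
    Enumerates Ck1 (λ V → (∣ V ∣ ≡ suc k) × Connected V) →
    -- Δ_{k+1} ≤ Λ_k Δ_k   and   δ_{k+1} ≤ Λ_k δ_k
    (sumR R (map EX Ck1) ≤R (Λ * sumR R (map EX Ck)))
    × (sumR R (map (λ V → EX V * mx V) Ck1) ≤R (Λ * sumR R (map (λ V → EX V * mx V) Ck)))
lemma2p1 R m N γ _ p p-bounds (suc k) (s≤s z≤n) Λ Λ-max mx mx-max Ck Ck1 Ck-enum Ck1-enum =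
  sum𝒞ₖ₊₁≤Λ*sum𝒞ₖ Ck-enum Ck1-enum λ≤Λ EX (λ {V} _ → EX≥0 V) (EX-extensionBound ∘ proj₂) ,
  sum𝒞ₖ₊₁≤Λ*sum𝒞ₖ Ck-enum Ck1-enum λ≤Λ (λ V → EX V * mx V) EX*mx≥0 EX*mx-extensionBound
  where
  open OrderedCommRing R using (_*_) renaming (_≤_ to infix 4 _≤R_)
  open Hyp R γ p
  open ExpectationProperties R γ p
  open NonNegative (λ ω → proj₁ (proj₁ (p-bounds ω)))
  open MaxEXi mx mx-max

  λ≤Λ : ∀ {V} → ∣ V ∣ ≡ suc k → lam V ≤R Λ
  λ≤Λ ∣V∣≡ = proj₂ Λ-max _ (≡.subst (λ n → 1 ≤ n × n ≤ suc k) (≡.sym ∣V∣≡) (s≤s z≤n , ≤-refl))
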